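{- For any two connected graphs $G_1$ and $G_2$, $$\chi_d^t(G_1\star G_2)\leq \chi_d^t(G_1)+|V(G_2)|.$$
   Context: All graphs are simple and finite. A total dominator coloring (TD-coloring) of a graph $G$ with no isolated vertex is a proper vertex coloring of $G$ in which every vertex of $G$ is adjacent to every vertex of some (other) color class. The total dominator chromatic number $\chi_d^t(G)$ is the minimum number of color classes in a TD-coloring of $G$. The neighbourhood corona $G_1\star G_2$ is the graph obtained by taking one copy of $G_1$ and $|V(G_1)|$ copies of $G_2$, and joining every neighbour (in $G_1$) of the $i$th vertex of $G_1$ to every vertex in the $i$th copy of $G_2$. -}

module Defs where

open import Data.Nat using (ℕ; _+_; _*_; _≤_; _<_; _≥_)
open import Data.Fin using (Fin; splitAt; remQuot; _≟_)
open import Data.Bool using (Bool; true; false; T; _∧_)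
open import Data.Sum using (_⊎_; inj₁; inj₂)
open import Data.Product using (Σ; ∃; _×_; _,_; proj₁; proj₂)
open import Relation.Nullary using (¬_; yes; no)
open import Relation.Nullary.Decidable using (⌊_⌋)
open import Data.Empty using (⊥-elim)
open import Relation.Binary.PropositionalEquality using (_≡_; refl) renaming (sym to ≡-sym)
open import Relation.Binary.Construct.Closure.ReflexiveTransitive using (Star)

record Graph : Set where
  field
    n     : ℕ
    adj   : Fin n → Fin n → Bool
    sym   : ∀ u v → adj u v ≡ adj v u
    irefl : ∀ u → adj u u ≡ false

open Graph public

∣V∣ : Graph → ℕ
∣V∣ G = n G

Adj : (G : Graph) → Fin (n G) → Fin (n G) → Set
Adj G u v = T (adj G u v)

Connected : Graph → Set
Connected G = (1 ≤ n G) × (∀ u v → Star (Adj G) u v)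

NoIsolated : Graph → Set
NoIsolated G = ∀ v → ∃ λ u → Adj G v u

-- A total dominator coloring of G with exactly k color classes:
-- a map c : V → Fin k that is surjective (so there are exactly k
-- nonempty color classes), proper, and such that every vertex v is
-- adjacent to every vertex of some color class j.
record TDColoring (G : Graph) (k : ℕ) : Set where
  field
    color    : Fin (n G) → Fin k
    onto     : ∀ (j : Fin k) → ∃ λ v → color v ≡ j
    proper   : ∀ u v → Adj G u v → ¬ (color u ≡ color v)
    dominate : ∀ v → ∃ λ (j : Fin k) → ∀ u → color u ≡ j → Adj G v u

IsTDChromatic : Graph → ℕ → Set
IsTDChromatic G k =
  NoIsolated G × TDColoring G k × (∀ m → m < k → ¬ TDColoring G m)

-- Vertex set Fin (n₁ + n₁ * n₂):
-- the first n₁ vertices are G₁; the vertex (i , x) of Fin (n₁ * n₂)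
-- (via remQuot) is vertex x of the i-th copy of G₂.
copyOf : (G₁ G₂ : Graph) → Fin (n G₁ * n G₂) → Fin (n G₁)
copyOf G₁ G₂ p = proj₁ (remQuot {n G₁} (n G₂) p)

vtxOf : (G₁ G₂ : Graph) → Fin (n G₁ * n G₂) → Fin (n G₂)
vtxOf G₁ G₂ p = proj₂ (remQuot {n G₁} (n G₂) p)

coronaAdj : (G₁ G₂ : Graph) → Fin (n G₁ + n G₁ * n G₂) → Fin (n G₁ + n G₁ * n G₂) → Bool
coronaAdj G₁ G₂ a b with splitAt (n G₁) a | splitAt (n G₁) b
... | inj₁ u | inj₁ v = adj G₁ u v
... | inj₁ u | inj₂ q = adj G₁ u (copyOf G₁ G₂ q)
... | inj₂ p | inj₁ v = adj G₁ (copyOf G₁ G₂ p) v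
... | inj₂ p | inj₂ q = ⌊ copyOf G₁ G₂ p ≟ copyOf G₁ G₂ q ⌋ ∧ adj G₂ (vtxOf G₁ G₂ p) (vtxOf G₁ G₂ q)

coronaSym : (G₁ G₂ : Graph) → ∀ a b → coronaAdj G₁ G₂ a b ≡ coronaAdj G₁ G₂ b a
coronaSym G₁ G₂ a b with splitAt (n G₁) a | splitAt (n G₁) b
... | inj₁ u | inj₁ v = sym G₁ u v
... | inj₁ u | inj₂ q = sym G₁ u (copyOf G₁ G₂ q)
... | inj₂ p | inj₁ v = sym G₁ (copyOf G₁ G₂ p) v
... | inj₂ p | inj₂ q with copyOf G₁ G₂ p ≟ copyOf G₁ G₂ q | copyOf G₁ G₂ q ≟ copyOf G₁ G₂ p
...   | yes _ | yes _ = sym G₂ (vtxOf G₁ G₂ p) (vtxOf G₁ G₂ q)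
...   | no _  | no _  = refl
...   | yes e | no ne = ⊥-elim (ne (≡-sym e))
...   | no ne | yes e = ⊥-elim (ne (≡-sym e))

coronaIrefl : (G₁ G₂ : Graph) → ∀ a → coronaAdj G₁ G₂ a a ≡ false
coronaIrefl G₁ G₂ a with splitAt (n G₁) a
... | inj₁ u = irefl G₁ u
... | inj₂ p with copyOf G₁ G₂ p ≟ copyOf G₁ G₂ p
...   | yes _ = irefl G₂ (vtxOf G₁ G₂ p)
...   | no _  = refl

_⋆_ : Graph → Graph → Graph
G₁ ⋆ G₂ = record
  { n     = n G₁ + n G₁ * n G₂
  ; adj   = coronaAdj G₁ G₂
  ; sym   = coronaSym G₁ G₂
  ; irefl = coronaIrefl G₁ G₂
  }

module Submission where

open import Defs
open import Data.Nat using (ℕ; _+_; _*_; _≤_; _≤?_)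
open import Data.Nat.Properties using (≰⇒>)
open import Data.Fin using (Fin; zero; suc; splitAt; _↑ˡ_; _↑ʳ_; combine)
open import Data.Fin.Properties
  using (suc-injective; ↑ˡ-injective; ↑ʳ-injective; splitAt-↑ˡ; splitAt-↑ʳ;
         splitAt⁻¹-↑ˡ; splitAt⁻¹-↑ʳ; remQuot-combine)
open import Data.Bool using (T)
open import Data.Bool.Properties using (T-∧)
open import Data.Sum using (inj₁; inj₂)
open import Data.Product using (∃; _×_; _,_; proj₂)
open import Function using (_∘_)
open import Function.Bundles using (Equivalence)
open import Relation.Nullary using (yes; no; contradiction)
open import Relation.Binary.PropositionalEquality
  using (_≡_; _≢_; refl; trans; cong; subst) renaming (sym to ≡-sym)

-- Colour G₁ by an optimal TD-colouring of G₁ and give every copy of G₂ the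
-- same n₂ fresh colours, vertex x of each copy receiving colour x.  Properness
-- is inherited from G₁ and from the copies; a vertex of G₁, or a vertex of the
-- i-th copy, is dominated by the class that dominates it, resp. i, in G₁,
-- since that class lies entirely in G₁.  The fresh colours are used as soon as
-- G₁ has a vertex, and minimality of χ_d^t(G₁ ⋆ G₂) gives the bound.

↑ˡ≢↑ʳ : ∀ {m n} (i : Fin m) (j : Fin n) → i ↑ˡ n ≢ m ↑ʳ j
↑ˡ≢↑ʳ zero    j ()
↑ˡ≢↑ʳ (suc i) j = ↑ˡ≢↑ʳ i j ∘ suc-injective

adjacent⇒≢ : (G : Graph) {u v : Fin (n G)} → Adj G u v → u ≢ v
adjacent⇒≢ G h refl = subst T (irefl G _) h

tdChromatic-minimal : {G : Graph} {k m : ℕ} → IsTDChromatic G k → TDColoring G m → k ≤ m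
tdChromatic-minimal {k = k} {m} (_ , _ , fewer-impossible) c with k ≤? m
... | yes k≤m = k≤m
... | no  k≰m = contradiction c (fewer-impossible m (≰⇒> k≰m))

module CoronaColoring (G₁ G₂ : Graph) {k₁ : ℕ} (c : TDColoring G₁ k₁) where
  open TDColoring c

  private
    n₁ = n G₁
    n₂ = n G₂

  embed : Fin n₁ → Fin (n (G₁ ⋆ G₂))
  embed v = v ↑ˡ (n₁ * n₂)

  -- the vertex of G₁ whose open neighbourhood a is joined to
  shadow : Fin (n (G₁ ⋆ G₂)) → Fin n₁
  shadow a with splitAt n₁ a
  ... | inj₁ u = u
  ... | inj₂ p = copyOf G₁ G₂ p

  shadow-adjacent : ∀ a v → Adj G₁ (shadow a) v → Adj (G₁ ⋆ G₂) a (embed v)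
  shadow-adjacent a v h with splitAt n₁ a | splitAt n₁ (embed v) | splitAt-↑ˡ n₁ v (n₁ * n₂)
  ... | inj₁ u | _ | refl = h
  ... | inj₂ p | _ | refl = h

  extend : Fin (n (G₁ ⋆ G₂)) → Fin (k₁ + n₂)
  extend a with splitAt n₁ a
  ... | inj₁ u = color u ↑ˡ n₂
  ... | inj₂ p = k₁ ↑ʳ vtxOf G₁ G₂ p

  extend-embed : ∀ v → extend (embed v) ≡ color v ↑ˡ n₂
  extend-embed v rewrite splitAt-↑ˡ n₁ v (n₁ * n₂) = refl

  extend-copy : (i : Fin n₁) (x : Fin n₂) → extend (n₁ ↑ʳ combine i x) ≡ k₁ ↑ʳ x
  extend-copy i x rewrite splitAt-↑ʳ n₁ (n₁ * n₂) (combine i x) =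
    cong (λ (_ , y) → k₁ ↑ʳ y) (remQuot-combine {n₁} {n₂} i x)

  extend-class : ∀ b j → extend b ≡ j ↑ˡ n₂ → ∃ λ v → embed v ≡ b × color v ≡ j
  extend-class b j e with splitAt n₁ b in split
  ... | inj₁ v = v , splitAt⁻¹-↑ˡ split , ↑ˡ-injective n₂ _ _ e
  ... | inj₂ p = contradiction (≡-sym e) (↑ˡ≢↑ʳ j _)

  extend-onto : Fin n₁ → ∀ j → ∃ λ a → extend a ≡ j
  extend-onto i j with splitAt k₁ j in split
  ... | inj₁ j₁ with onto j₁
  ...   | v , refl = embed v , trans (extend-embed v) (splitAt⁻¹-↑ˡ split)
  extend-onto i j | inj₂ x = n₁ ↑ʳ combine i x , trans (extend-copy i x) (splitAt⁻¹-↑ʳ split)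

  extend-proper : ∀ a b → Adj (G₁ ⋆ G₂) a b → extend a ≢ extend b
  extend-proper a b h with splitAt n₁ a | splitAt n₁ b
  ... | inj₁ u | inj₁ v = proper u v h ∘ ↑ˡ-injective n₂ _ _
  ... | inj₁ u | inj₂ q = ↑ˡ≢↑ʳ _ _
  ... | inj₂ p | inj₁ v = ↑ˡ≢↑ʳ _ _ ∘ ≡-sym
  ... | inj₂ p | inj₂ q =
    adjacent⇒≢ G₂ (proj₂ (Equivalence.to T-∧ h)) ∘ ↑ʳ-injective k₁ _ _

  extend-dominate : ∀ a → ∃ λ j → ∀ b → extend b ≡ j → Adj (G₁ ⋆ G₂) a b
  extend-dominate a with dominate (shadow a)
  ... | j , dominated = j ↑ˡ n₂ , dominated-by-class
    where
    dominated-by-class : ∀ b → extend b ≡ j ↑ˡ n₂ → Adj (G₁ ⋆ G₂) a b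
    dominated-by-class b e with extend-class b j e
    ... | v , refl , colour-v = shadow-adjacent a v (dominated v colour-v)

  coronaTDColoring : Fin n₁ → TDColoring (G₁ ⋆ G₂) (k₁ + n₂)
  coronaTDColoring i = record
    { color    = extend
    ; onto     = extend-onto i
    ; proper   = extend-proper
    ; dominate = extend-dominate
    }

theorem2p2 : (G₁ G₂ : Graph) → Connected G₁ → Connected G₂ →
    (k₁ k : ℕ) → IsTDChromatic G₁ k₁ → IsTDChromatic (G₁ ⋆ G₂) k →
    k ≤ k₁ + ∣V∣ G₂
theorem2p2 G₁ G₂ (nonempty , _) _ k₁ k (_ , c , _) χ-corona =
  tdChromatic-minimal χ-corona (CoronaColoring.coronaTDColoring G₁ G₂ c (vertex nonempty))
  where
  vertex : ∀ {m} → 1 ≤ m → Fin m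
  vertex {ℕ.suc _} _ = zero
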